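{- For every odd integer $a \geq 7$, \[ R_3\bigl(ax+ay=(a+1)z\bigr) \geq a^3(a+1). \]
   Context: For a linear equation $\mathcal{E}$ in the unknowns $x,y,z$ and a positive integer $k$, the $k$-colour Rado number $R_k(\mathcal{E})$ is the smallest positive integer $n$, if it exists, such that every colouring of $\{1,2,\dots,n\}$ with $k$ colours contains a monochromatic solution to $\mathcal{E}$, i.e. a solution $(x,y,z)$ with $x,y,z\in\{1,\dots,n\}$ (not necessarily distinct) all of the same colour; $R_k(\mathcal{E})=\infty$ if no such $n$ exists. In the paper's notation the equation $ax+ay=(a+1)z$ is written $\mathcal{E}(3,0;a,a,a+1)$. -}

module Defs where

open import Data.Nat using (ℕ; _+_; _*_; _≤_; _^_; suc)
open import Data.Fin using (Fin)
open import Data.Product using (Σ; ∃; _×_; _,_)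
open import Relation.Binary.PropositionalEquality using (_≡_)

InRange : ℕ → ℕ → Set
InRange n x = (1 ≤ x) × (x ≤ n)

SolvesE : ℕ → ℕ → ℕ → ℕ → Set
SolvesE a x y z = a * x + a * y ≡ (a + 1) * z

-- A k-colouring of {1,...,n} is given by c : ℕ → Fin k (values outside
-- {1,...,n} are irrelevant).  The colouring c has a monochromatic solution
-- in {1,...,n}.
HasMonoSolution : (a n k : ℕ) → (ℕ → Fin k) → Set
HasMonoSolution a n k c =
  Σ ℕ λ x → Σ ℕ λ y → Σ ℕ λ z →
    InRange n x × InRange n y × InRange n z ×
    SolvesE a x y z × (c x ≡ c y) × (c y ≡ c z)

RadoProperty : (a k n : ℕ) → Set
RadoProperty a k n = (c : ℕ → Fin k) → HasMonoSolution a n k c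

-- R_k(E) ≥ N : every n with the Rado property is ≥ N, i.e. the least such n
-- (if it exists) is ≥ N; vacuous when R_k(E) = ∞.
RadoNumberGE : (a k N : ℕ) → Set
RadoNumberGE a k N = (n : ℕ) → 1 ≤ n → RadoProperty a k n → N ≤ n

IsOdd : ℕ → Set
IsOdd a = Σ ℕ λ m → a ≡ 2 * m + 1

-- Write a = 2k + 1.  Every solution of a x + a y = (a + 1) z has z = q a and x + y = (a + 1) q.
-- Colour n by its a-adic valuation: if a ∤ n, by whether n % a ≤ k, which separates two residues
-- summing to a; if a divides n exactly once, by a colour of its own, because a ∣ x and a ∣ y force
-- a ∣ q, i.e. a² ∣ z; if a² ∣ n, by a 2-colouring χ of n / a².  A monochromatic solution with a² ∣ z
-- must then have a² ∣ x, y as well and divides down to a χ-monochromatic one, so a χ with no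
-- monochromatic solution below N lifts to a 3-colouring with none below N a².  Such a χ exists for
-- N = (a + 1) a: colour q a by whether q < a, and q a + r (0 < r < a) by comparing q with r,
-- breaking the tie q = r by whether r ≤ k.

module Submission where

open import Defs
open import Data.Nat using (ℕ; zero; suc; _+_; _*_; _^_; _%_; _≤_; _<_; s≤s; z≤n; NonZero; >-nonZero)
open import Data.Nat.Properties
open import Data.Nat.DivMod using (%-distribˡ-+; %-remove-+ˡ; m<n⇒m%n≡m; m%n≤m; m%n<n)
open import Data.Nat.Divisibility
  using (_∣_; divides; _∣?_; ∣m+n∣m⇒∣n; ∣m∣n⇒∣m+n; ∣n⇒∣m*n; m∣m*n; n∣m*n; m%n≡0⇒n∣m; n∣m⇒m%n≡0)
open import Data.Nat.Tactic.RingSolver using (solve)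
open import Data.Fin.Base using (Fin; zero; suc)
import Data.Fin.Properties as Fin
open import Data.List.Base using (_∷_; [])
open import Data.Product using (_×_; _,_; proj₁; proj₂)
open import Data.Empty using (⊥)
open import Relation.Nullary using (¬_; yes; no; contradiction)
open import Relation.Binary.Definitions using (tri<; tri≈; tri>)
open import Relation.Binary.PropositionalEquality
open ≡-Reasoning

+-squeeze : ∀ {p q r s} → p ≤ q → r ≤ s → q + s ≤ p + r → p ≡ q × r ≡ s
+-squeeze {p} {q} {r} {s} p≤q r≤s q+s≤p+r =
  ≤-antisym p≤q (+-cancelʳ-≤ s q p (≤-trans q+s≤p+r (+-monoʳ-≤ p r≤s))) ,
  ≤-antisym r≤s (+-cancelˡ-≤ q s r (≤-trans q+s≤p+r (+-monoˡ-≤ r p≤q)))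

1≤m*n⇒1≤m : ∀ m {n} → 1 ≤ m * n → 1 ≤ m
1≤m*n⇒1≤m zero ()
1≤m*n⇒1≤m (suc _) _ = s≤s z≤n

[n+1]*m≡n*m+m : ∀ n m → (n + 1) * m ≡ n * m + m
[n+1]*m≡n*m+m n m = trans (cong (_* m) (+-comm n 1)) (+-comm m (n * m))

∣[n+1]*m⇒∣m : ∀ n {m} → n ∣ (n + 1) * m → n ∣ m
∣[n+1]*m⇒∣m n {m} n∣[n+1]*m =
  ∣m+n∣m⇒∣n (subst (n ∣_) ([n+1]*m≡n*m+m n m) n∣[n+1]*m) (m∣m*n m)

[n+1]*m%n≡m : ∀ n {m} .{{_ : NonZero n}} → m < n → (n + 1) * m % n ≡ m
[n+1]*m%n≡m n {m} m<n = begin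
  (n + 1) * m % n ≡⟨ cong (_% n) ([n+1]*m≡n*m+m n m) ⟩
  (n * m + m) % n ≡⟨ %-remove-+ˡ m (m∣m*n m) ⟩
  m % n           ≡⟨ m<n⇒m%n≡m m<n ⟩
  m               ∎

m%n+o%n≡n : ∀ {m n o} .{{_ : NonZero n}} → ¬ n ∣ m → n ∣ m + o → m % n + o % n ≡ n
m%n+o%n≡n {m} {n} {o} n∤m n∣m+o with m%n≡0⇒n∣m (m % n + o % n) n
  (trans (sym (%-distribˡ-+ m o n)) (n∣m⇒m%n≡0 (m + o) n n∣m+o))
... | divides zero s≡0 = contradiction (m%n≡0⇒n∣m m n (m+n≡0⇒m≡0 (m % n) s≡0)) n∤m
... | divides (suc zero) s≡n = trans s≡n (+-identityʳ n)
... | divides (suc (suc q)) s≡[2+q]*n = contradiction s≡[2+q]*n (<⇒≢ s<2n)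
  where
  s<2n : m % n + o % n < n + (n + q * n)
  s<2n = +-mono-<-≤ (m%n<n m n) (≤-trans (<⇒≤ (m%n<n o n)) (m≤m+n n (q * n)))

SolvesE⇒a∣z : ∀ {a x y z} → SolvesE a x y z → a ∣ z
SolvesE⇒a∣z {a} {x} {y} sol =
  ∣[n+1]*m⇒∣m a (subst (a ∣_) sol (∣m∣n⇒∣m+n (m∣m*n x) (m∣m*n y)))

SolvesE⇒x+y≡[a+1]*q : ∀ {a x y z q} .{{_ : NonZero a}} → SolvesE a x y z → z ≡ q * a →
                      x + y ≡ (a + 1) * q
SolvesE⇒x+y≡[a+1]*q {a} {x} {y} {z} {q} sol z≡q*a = *-cancelˡ-≡ (x + y) ((a + 1) * q) a (begin
  a * (x + y)       ≡⟨ *-distribˡ-+ a x y ⟩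
  a * x + a * y     ≡⟨ sol ⟩
  (a + 1) * z       ≡⟨ cong ((a + 1) *_) z≡q*a ⟩
  (a + 1) * (q * a) ≡⟨ solve (a ∷ q ∷ []) ⟩
  a * ((a + 1) * q) ∎)

SolvesE-cancelʳ : ∀ {a x y z x′ y′ z′} d .{{_ : NonZero d}} →
                  x ≡ x′ * d → y ≡ y′ * d → z ≡ z′ * d → SolvesE a x y z → SolvesE a x′ y′ z′
SolvesE-cancelʳ {a} {x′ = x′} {y′} {z′} d refl refl refl sol =
  *-cancelʳ-≡ (a * x′ + a * y′) ((a + 1) * z′) d (begin
    (a * x′ + a * y′) * d       ≡⟨ *-distribʳ-+ d (a * x′) (a * y′) ⟩
    a * x′ * d + a * y′ * d     ≡⟨ cong₂ _+_ (*-assoc a x′ d) (*-assoc a y′ d) ⟩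
    a * (x′ * d) + a * (y′ * d) ≡⟨ sol ⟩
    (a + 1) * (z′ * d)          ≡⟨ sym (*-assoc (a + 1) z′ d) ⟩
    (a + 1) * z′ * d            ∎)

[n+1]*n*[n*n]≡n^3*[n+1] : ∀ n → (n + 1) * n * (n * n) ≡ n ^ 3 * (n + 1)
[n+1]*n*[n*n]≡n^3*[n+1] n = unfolded
  where
  -- the solver does not recognise _^_ with a literal exponent
  unfolded : (n + 1) * n * (n * n) ≡ n * (n * (n * 1)) * (n + 1)
  unfolded = solve (n ∷ [])

NoMonoSolutionBelow : (a N : ℕ) {k : ℕ} → (ℕ → Fin k) → Set
NoMonoSolutionBelow a N c = ∀ {x y z} → 1 ≤ x → 1 ≤ y → 1 ≤ z → z < N →
                            SolvesE a x y z → c x ≡ c y → c y ≡ c z → ⊥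

NoMonoSolutionBelow⇒RadoNumberGE : ∀ {a k N} {c : ℕ → Fin k} →
                                   NoMonoSolutionBelow a N c → RadoNumberGE a k N
NoMonoSolutionBelow⇒RadoNumberGE {a} {k} {N} {c} no-mono n _ rado = ≮⇒≥ λ n<N → refute n<N (rado c)
  where
  refute : n < N → HasMonoSolution a n k c → ⊥
  refute n<N (_ , _ , _ , (1≤x , _) , (1≤y , _) , (1≤z , z≤n′) , sol , cx≡cy , cy≡cz) =
    no-mono 1≤x 1≤y 1≤z (≤-<-trans z≤n′ n<N) sol cx≡cy cy≡cz

module OddModulus (k : ℕ) where

  a : ℕ
  a = 2 * k + 1

  instance
    a-nonZero : NonZero a
    a-nonZero = >-nonZero (m≤n+m 1 (2 * k))

    a+1-nonZero : NonZero (a + 1)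
    a+1-nonZero = >-nonZero (m≤n+m 1 a)

  a≡1+k+k : a ≡ suc (k + k)
  a≡1+k+k = trans (+-comm (2 * k) 1) (cong (λ n → suc (k + n)) (+-identityʳ k))

  low+low<a : ∀ {r s} → r ≤ k → s ≤ k → r + s < a
  low+low<a {r} {s} r≤k s≤k = subst (r + s <_) (sym a≡1+k+k) (s≤s (+-mono-≤ r≤k s≤k))

  a<high+high : ∀ {r s} → k < r → k < s → a < r + s
  a<high+high {r} {s} k<r k<s = subst (_< r + s) (sym a≡1+k+k)
    (<-≤-trans (s≤s (+-monoʳ-< k (n<1+n k))) (+-mono-≤ k<r k<s))

  data Half (r : ℕ) : Fin 2 → Set where
    lower : r ≤ k → Half r zero
    upper : k < r → Half r (suc zero)

  halfColour : ℕ → Fin 2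
  halfColour r with r ≤? k
  ... | yes _ = zero
  ... | no _ = suc zero

  half : ∀ r → Half r (halfColour r)
  half r with r ≤? k
  ... | yes r≤k = lower r≤k
  ... | no r≰k = upper (≰⇒> r≰k)

  Half-complement : ∀ {r s c} → Half r c → Half s c → r + s ≢ a
  Half-complement (lower r≤k) (lower s≤k) = <⇒≢ (low+low<a r≤k s≤k)
  Half-complement (upper k<r) (upper k<s) = >⇒≢ (a<high+high k<r k<s)

module Base (k : ℕ) where

  open OddModulus k

  -- for m = q a + r with r = m % a, comparing m with diagonal m compares q with r
  diagonal : ℕ → ℕ
  diagonal m = (a + 1) * (m % a)

  Above Below : ℕ → Set
  Above m = diagonal m ≤ m × (m ≡ diagonal m → k < m % a)
  Below m = m ≤ diagonal m × (m ≡ diagonal m → m % a ≤ k)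

  base : ℕ → Fin 2
  base m with a ∣? m
  ... | yes (divides q _) with q <? a
  ...   | yes _ = suc zero
  ...   | no _ = zero
  base m | no _ with <-cmp m (diagonal m)
  ... | tri< _ _ _ = zero
  ... | tri≈ _ _ _ = halfColour (m % a)
  ... | tri> _ _ _ = suc zero

  data Shape (m : ℕ) : Fin 2 → Set where
    small-multiple : ∀ q → m ≡ q * a → q < a → Shape m (suc zero)
    large-multiple : ∀ q → m ≡ q * a → a ≤ q → Shape m zero
    above : ¬ a ∣ m → Above m → Shape m (suc zero)
    below : ¬ a ∣ m → Below m → Shape m zero

  on-diagonal : ∀ {m c} → ¬ a ∣ m → m ≡ diagonal m → Half (m % a) c → Shape m c
  on-diagonal a∤m m≡d (lower r≤k) = below a∤m (≤-reflexive m≡d , λ _ → r≤k)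
  on-diagonal a∤m m≡d (upper k<r) = above a∤m (≤-reflexive (sym m≡d) , λ _ → k<r)

  shape : ∀ m → Shape m (base m)
  shape m with a ∣? m
  ... | yes (divides q m≡q*a) with q <? a
  ...   | yes q<a = small-multiple q m≡q*a q<a
  ...   | no q≮a = large-multiple q m≡q*a (≮⇒≥ q≮a)
  shape m | no a∤m with <-cmp m (diagonal m)
  ... | tri< m<d _ _ = below a∤m (<⇒≤ m<d , λ m≡d → contradiction m≡d (<⇒≢ m<d))
  ... | tri≈ _ m≡d _ = on-diagonal a∤m m≡d (half (m % a))
  ... | tri> _ _ d<m = above a∤m (<⇒≤ d<m , λ m≡d → contradiction (sym m≡d) (<⇒≢ d<m))

  multiple⇒Above : ∀ {m} → 1 ≤ m → a ∣ m → Above m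
  multiple⇒Above {m} 1≤m a∣m =
    subst (_≤ m) (sym d≡0) z≤n , λ m≡d → contradiction (sym (trans m≡d d≡0)) (<⇒≢ 1≤m)
    where
    d≡0 : diagonal m ≡ 0
    d≡0 = trans (cong ((a + 1) *_) (n∣m⇒m%n≡0 m a a∣m)) (*-zeroʳ (a + 1))

  colour-one⇒Above : ∀ {m} → 1 ≤ m → Shape m (suc zero) → Above m
  colour-one⇒Above 1≤m (small-multiple q m≡q*a _) = multiple⇒Above 1≤m (divides q m≡q*a)
  colour-one⇒Above _ (above _ m-above) = m-above

  Above-pair : ∀ {x y q} → Above x → Above y → x + y ≡ (a + 1) * q → q < a → ⊥
  Above-pair {x} {y} {q} (dx≤x , x-tie) (dy≤y , y-tie) x+y≡[a+1]*q q<a =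
    <-asym q<a (subst (a <_) rx+ry≡q (a<high+high (x-tie (sym dx≡x)) (y-tie (sym dy≡y))))
    where
    q≤rx+ry : q ≤ x % a + y % a
    q≤rx+ry = subst (_≤ x % a + y % a) [rx+ry]%a≡q (m%n≤m (x % a + y % a) a)
      where
      [rx+ry]%a≡q : (x % a + y % a) % a ≡ q
      [rx+ry]%a≡q = begin
        (x % a + y % a) % a ≡⟨ sym (%-distribˡ-+ x y a) ⟩
        (x + y) % a         ≡⟨ cong (_% a) x+y≡[a+1]*q ⟩
        (a + 1) * q % a     ≡⟨ [n+1]*m%n≡m a q<a ⟩
        q                   ∎
    dx≡x×dy≡y : diagonal x ≡ x × diagonal y ≡ y
    dx≡x×dy≡y = +-squeeze dx≤x dy≤y (≤-trans (≤-reflexive x+y≡[a+1]*q)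
      (≤-trans (*-monoʳ-≤ (a + 1) q≤rx+ry) (≤-reflexive (*-distribˡ-+ (a + 1) (x % a) (y % a)))))
    dx≡x = proj₁ dx≡x×dy≡y
    dy≡y = proj₂ dx≡x×dy≡y
    rx+ry≡q : x % a + y % a ≡ q
    rx+ry≡q = *-cancelˡ-≡ (x % a + y % a) q (a + 1) (begin
      (a + 1) * (x % a + y % a) ≡⟨ *-distribˡ-+ (a + 1) (x % a) (y % a) ⟩
      diagonal x + diagonal y   ≡⟨ cong₂ _+_ dx≡x dy≡y ⟩
      x + y                     ≡⟨ x+y≡[a+1]*q ⟩
      (a + 1) * q               ∎)

  Below-pair : ∀ {x y} → ¬ a ∣ x → Below x → Below y → x + y ≢ (a + 1) * a
  Below-pair {x} {y} a∤x (x≤dx , x-tie) (y≤dy , y-tie) x+y≡[a+1]*a =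
    <⇒≢ (low+low<a (x-tie x≡dx) (y-tie y≡dy)) rx+ry≡a
    where
    rx+ry≡a : x % a + y % a ≡ a
    rx+ry≡a = m%n+o%n≡n a∤x (divides (a + 1) x+y≡[a+1]*a)
    x≡dx×y≡dy : x ≡ diagonal x × y ≡ diagonal y
    x≡dx×y≡dy = +-squeeze x≤dx y≤dy (≤-reflexive (begin
      diagonal x + diagonal y   ≡⟨ sym (*-distribˡ-+ (a + 1) (x % a) (y % a)) ⟩
      (a + 1) * (x % a + y % a) ≡⟨ cong ((a + 1) *_) rx+ry≡a ⟩
      (a + 1) * a               ≡⟨ sym x+y≡[a+1]*a ⟩
      x + y                     ∎))
    x≡dx = proj₁ x≡dx×y≡dy
    y≡dy = proj₂ x≡dx×y≡dy

  large-multiples-pair : ∀ {x y qx qy} → 1 < a → x ≡ qx * a → a ≤ qx → y ≡ qy * a → a ≤ qy →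
                         x + y ≢ (a + 1) * a
  large-multiples-pair {qx = qx} {qy} 1<a refl a≤qx refl a≤qy x+y≡[a+1]*a =
    <⇒≢ [a+1]*a<x+y (sym x+y≡[a+1]*a)
    where
    [a+1]*a<x+y : (a + 1) * a < qx * a + qy * a
    [a+1]*a<x+y = subst (_< qx * a + qy * a) (sym ([n+1]*m≡n*m+m a a))
      (<-≤-trans (+-monoʳ-< (a * a) (m<m*n a a 1<a))
                 (+-mono-≤ (*-monoˡ-≤ a a≤qx) (*-monoˡ-≤ a a≤qy)))

  colour-zero-pair : ∀ {x y} → 1 < a → Shape x zero → Shape y zero → x + y ≢ (a + 1) * a
  colour-zero-pair 1<a (large-multiple qx x≡qx*a a≤qx) (large-multiple qy y≡qy*a a≤qy) =
    large-multiples-pair 1<a x≡qx*a a≤qx y≡qy*a a≤qy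
  colour-zero-pair _ (large-multiple qx x≡qx*a _) (below a∤y _) x+y≡[a+1]*a =
    a∤y (∣m+n∣m⇒∣n (divides (a + 1) x+y≡[a+1]*a) (divides qx x≡qx*a))
  colour-zero-pair {x} {y} _ (below a∤x _) (large-multiple qy y≡qy*a _) x+y≡[a+1]*a =
    a∤x (∣m+n∣m⇒∣n (divides (a + 1) (trans (+-comm y x) x+y≡[a+1]*a)) (divides qy y≡qy*a))
  colour-zero-pair _ (below a∤x x-below) (below _ y-below) = Below-pair a∤x x-below y-below

  base-free : 1 < a → NoMonoSolutionBelow a ((a + 1) * a) base
  base-free 1<a {x} {y} {w} 1≤x 1≤y _ w<[a+1]*a sol cx≡cy cy≡cw =
    by-shape (shape w) (trans cx≡cy cy≡cw) cy≡cw
    where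
    by-shape : ∀ {c} → Shape w c → base x ≡ c → base y ≡ c → ⊥
    by-shape (small-multiple q w≡q*a q<a) cx cy =
      Above-pair (colour-one⇒Above 1≤x (subst (Shape x) cx (shape x)))
                 (colour-one⇒Above 1≤y (subst (Shape y) cy (shape y)))
                 (SolvesE⇒x+y≡[a+1]*q sol w≡q*a) q<a
    by-shape (large-multiple q w≡q*a a≤q) cx cy =
      colour-zero-pair 1<a (subst (Shape x) cx (shape x)) (subst (Shape y) cy (shape y))
                       (subst (λ q → x + y ≡ (a + 1) * q) q≡a (SolvesE⇒x+y≡[a+1]*q sol w≡q*a))
      where
      q<a+1 : q < a + 1
      q<a+1 = *-cancelʳ-< a q (a + 1) (subst (_< (a + 1) * a) w≡q*a w<[a+1]*a)
      q≡a : q ≡ a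
      q≡a = ≤-antisym (m<1+n⇒m≤n (subst (q <_) (+-comm a 1) q<a+1)) a≤q
    by-shape (above a∤w _) _ _ = a∤w (SolvesE⇒a∣z sol)
    by-shape (below a∤w _) _ _ = a∤w (SolvesE⇒a∣z sol)

module Lift (k : ℕ) (χ : ℕ → Fin 2) where

  open OddModulus k

  lifted : ℕ → Fin 3
  lifted n with a ∣? n
  ... | no _ = suc (halfColour (n % a))
  ... | yes (divides q _) with a ∣? q
  ...   | no _ = zero
  ...   | yes (divides w _) = suc (χ w)

  data Shape (n : ℕ) : Fin 3 → Set where
    not-divisible : ∀ {c} → ¬ a ∣ n → Half (n % a) c → Shape n (suc c)
    divisible-once : ∀ q → n ≡ q * a → ¬ a ∣ q → Shape n zero
    divisible-twice : ∀ w → n ≡ w * (a * a) → Shape n (suc (χ w))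

  shape : ∀ n → Shape n (lifted n)
  shape n with a ∣? n
  ... | no a∤n = not-divisible a∤n (half (n % a))
  ... | yes (divides q n≡q*a) with a ∣? q
  ...   | no a∤q = divisible-once q n≡q*a a∤q
  ...   | yes (divides w q≡w*a) =
    divisible-twice w (trans n≡q*a (trans (cong (_* a) q≡w*a) (*-assoc w a a)))

  a∣w*[a*a] : ∀ w → a ∣ w * (a * a)
  a∣w*[a*a] w = ∣n⇒∣m*n w (m∣m*n a)

  lifted-free : ∀ {N} → NoMonoSolutionBelow a N χ → NoMonoSolutionBelow a (N * (a * a)) lifted
  lifted-free {N} χ-free {x} {y} {z} 1≤x 1≤y 1≤z z<N*a² sol =
    by-shape (shape x) (shape y) (shape z)
    where
    a∣x+y : ∀ w → z ≡ w * (a * a) → a ∣ x + y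
    a∣x+y w z≡w*a² =
      subst (a ∣_) (sym (SolvesE⇒x+y≡[a+1]*q sol (trans z≡w*a² (sym (*-assoc w a a)))))
            (∣n⇒∣m*n (a + 1) (n∣m*n w))

    by-shape : ∀ {cx cy cz} → Shape x cx → Shape y cy → Shape z cz → cx ≡ cy → cy ≡ cz → ⊥
    by-shape _ _ (not-divisible a∤z _) _ _ = a∤z (SolvesE⇒a∣z sol)
    by-shape (divisible-once qx x≡qx*a _) (divisible-once qy y≡qy*a _)
             (divisible-once q z≡q*a a∤q) _ _ =
      a∤q (∣[n+1]*m⇒∣m a (subst (a ∣_) (SolvesE⇒x+y≡[a+1]*q sol z≡q*a)
                                      (∣m∣n⇒∣m+n (divides qx x≡qx*a) (divides qy y≡qy*a))))
    by-shape _ (not-divisible _ _) (divisible-once _ _ _) _ ()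
    by-shape _ (divisible-twice _ _) (divisible-once _ _ _) _ ()
    by-shape (not-divisible _ _) (divisible-once _ _ _) (divisible-once _ _ _) () _
    by-shape (divisible-twice _ _) (divisible-once _ _ _) (divisible-once _ _ _) () _
    by-shape _ (divisible-once _ _ _) (divisible-twice _ _) _ ()
    by-shape (divisible-once _ _ _) (not-divisible _ _) (divisible-twice _ _) () _
    by-shape (divisible-once _ _ _) (divisible-twice _ _) (divisible-twice _ _) () _
    by-shape (not-divisible a∤x x-half) (not-divisible _ y-half) (divisible-twice w z≡w*a²) refl _ =
      Half-complement x-half y-half (m%n+o%n≡n a∤x (a∣x+y w z≡w*a²))
    by-shape (not-divisible a∤x _) (divisible-twice wy y≡wy*a²) (divisible-twice w z≡w*a²) _ _ =
      a∤x (∣m+n∣m⇒∣n (subst (a ∣_) (+-comm x y) (a∣x+y w z≡w*a²))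
                     (subst (a ∣_) (sym y≡wy*a²) (a∣w*[a*a] wy)))
    by-shape (divisible-twice wx x≡wx*a²) (not-divisible a∤y _) (divisible-twice w z≡w*a²) _ _ =
      a∤y (∣m+n∣m⇒∣n (a∣x+y w z≡w*a²) (subst (a ∣_) (sym x≡wx*a²) (a∣w*[a*a] wx)))
    by-shape (divisible-twice wx x≡wx*a²) (divisible-twice wy y≡wy*a²)
             (divisible-twice w z≡w*a²) cx≡cy cy≡cz =
      χ-free (1≤m*n⇒1≤m wx (subst (1 ≤_) x≡wx*a² 1≤x))
             (1≤m*n⇒1≤m wy (subst (1 ≤_) y≡wy*a² 1≤y))
             (1≤m*n⇒1≤m w (subst (1 ≤_) z≡w*a² 1≤z))
             (*-cancelʳ-< (a * a) w N (subst (_< N * (a * a)) z≡w*a² z<N*a²))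
             (SolvesE-cancelʳ {a} (a * a) {{m*n≢0 a a}} x≡wx*a² y≡wy*a² z≡w*a² sol)
             (Fin.suc-injective cx≡cy) (Fin.suc-injective cy≡cz)

theorem4 : (a : ℕ) → IsOdd a → 7 ≤ a → RadoNumberGE a 3 (a ^ 3 * (a + 1))
theorem4 _ (k , refl) 7≤a = NoMonoSolutionBelow⇒RadoNumberGE {a}
  (subst (λ N → NoMonoSolutionBelow a N lifted) ([n+1]*n*[n*n]≡n^3*[n+1] a)
         (lifted-free (base-free 1<a)))
  where
  open OddModulus k
  open Base k using (base; base-free)
  open Lift k base using (lifted; lifted-free)

  1<a : 1 < a
  1<a = ≤-trans (s≤s (s≤s z≤n)) 7≤a
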